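{- Let $\mathcal{X}$ be a Cayley scheme over a finite abelian group $G$, and let $U,L\in\mathfrak{S}(\mathcal{X})$ with $L\le U$ be such that $\mathcal{X}$ is the $U/L$-wreath product and $$\mathrm{Aut}(\mathcal{X}_{G/L})^{U/L}=\mathrm{Aut}(\mathcal{X}_U)^{U/L}.$$ Then $\mathrm{Aut}(\mathcal{X})^U=\mathrm{Aut}(\mathcal{X}_U)$ and $\mathrm{Aut}(\mathcal{X})^{G/L}=\mathrm{Aut}(\mathcal{X}_{G/L})$.
   Context: A coherent configuration on a finite set $\Omega$ is a pair $(\Omega,S)$, $S$ a partition of $\Omega\times\Omega$ such that $1_\Omega$ is a union of elements of $S$, $S$ is closed under transposition $s\mapsto s^*$, and for $r,s,t\in S$ the number $|\alpha r\cap\beta s^*|$ (with $\alpha r=\{\beta':(\alpha,\beta')\in r\}$) is independent of $(\alpha,\beta)\in t$. Its automorphism group $\mathrm{Aut}$ consists of the permutations fixing every element of $S$. For a group $G$, $G_{right}$ is the group of right multiplications $x\mapsto xg$. A Cayley scheme over $G$ is a coherent configuration $\mathcal{X}=(G,S)$ with $G_{right}\le\mathrm{Aut}(\mathcal{X})$. For every equivalence relation $E$ on $G$ that is a union of basis relations, the class $H_E$ of $E$ containing the identity is a subgroup and the classes of $E$ are the cosets of $H_E$; $\mathfrak{S}(\mathcal{X})$ is the set of all such subgroups $H_E$, and for $H\in\mathfrak{S}(\mathcal{X})$ let $E_H$ be the corresponding equivalence relation. For $H\in\mathfrak{S}(\mathcal{X})$: the restriction $\mathcal{X}_H=(H,\{s\cap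 (H\times H)\ne\varnothing: s\in S\})$, and the quotient $\mathcal{X}_{G/H}$ is the coherent configuration on the set $G/H$ of cosets whose basis relations are $s_{G/H}=\{(\Lambda,\Delta): s\cap(\Lambda\times\Delta)\ne\varnothing\}$, $s\in S$. For $L\le U$ in $\mathfrak{S}(\mathcal{X})$, $U/L$ is the set of $L$-cosets contained in $U$. $\mathcal{X}$ is the $U/L$-wreath product if every basis relation $r$ with $r\cap E_U=\varnothing$ is a union of sets $\Delta\times\Lambda$ with $\Delta,\Lambda$ cosets of $L$. For a permutation group $K$ and a set $\Delta$ (or set of blocks), $K^\Delta$ denotes the permutation group induced on $\Delta$ by the setwise stabilizer of $\Delta$ in $K$; e.g. $\mathrm{Aut}(\mathcal{X})^{G/L}$ is the group induced on the cosets of $L$, $\mathrm{Aut}(\mathcal{X}_{G/L})^{U/L}$ the group induced on $U/L$ by its setwise stabilizer in $\mathrm{Aut}(\mathcal{X}_{G/L})$, and $\mathrm{Aut}(\mathcal{X}_U)^{U/L}$ the group induced by $\mathrm{Aut}(\mathcal{X}_U)$ on the $L$-cosets in $U$. -}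

module Defs where

open import Data.Nat using (ℕ)
open import Data.Fin using (Fin)
open import Data.Fin.Properties using (_≟_)
open import Data.Fin.Subset using (Subset; _∈_; _⊆_)
open import Data.Bool using (Bool; true)
open import Data.List using (length; filter; allFin)
open import Data.Product using (Σ; ∃; ∃-syntax; _×_; _,_)
open import Relation.Nullary using (¬_)
open import Relation.Nullary.Decidable using (_×-dec_)
open import Relation.Binary.PropositionalEquality using (_≡_)
open import Function.Bundles using (_⇔_)

record FinAbGroup : Set where
  infixl 7 _∙_
  infix 8 _⁻¹
  field
    n         : ℕ
    _∙_       : Fin n → Fin n → Fin n
    e         : Fin n
    _⁻¹       : Fin n → Fin n
    assoc     : ∀ x y z → (x ∙ y) ∙ z ≡ x ∙ (y ∙ z)
    identityˡ : ∀ x → e ∙ x ≡ x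
    inverseˡ  : ∀ x → x ⁻¹ ∙ x ≡ e
    comm      : ∀ x y → x ∙ y ≡ y ∙ x

-- The partition S of Ω × Ω into
-- basis relations is given by a surjective colouring c : Ω → Ω → Fin m;
-- the basis relation with index r is { (x , y) : c x y ≡ r }.

module _ {n : ℕ} where

  -- number of γ with (α,γ) ∈ r and (β,γ) ∈ s', i.e. |α r ∩ β s'|
  interCount : ∀ {m} → (Fin n → Fin n → Fin m) → Fin n → Fin n → Fin m → Fin m → ℕ
  interCount c α β r s' =
    length (filter (λ γ → (c α γ ≟ r) ×-dec (c β γ ≟ s')) (allFin n))

record CoherentConfiguration (n : ℕ) : Set where
  field
    m        : ℕ
    c        : Fin n → Fin n → Fin m
    -- every basis relation is nonempty (S is a partition)
    nonempty : ∀ r → ∃[ x ] ∃[ y ] c x y ≡ r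
    -- 1_Ω is a union of basis relations
    diagonal : ∀ x y z → c x y ≡ c z z → x ≡ y
    star     : Fin m → Fin m
    transp   : ∀ x y → c y x ≡ star (c x y)
    regular  : ∀ r s t α β α′ β′ → c α β ≡ t → c α′ β′ ≡ t →
               interCount c α β r (star s) ≡ interCount c α′ β′ r (star s)

record CayleyScheme (G : FinAbGroup) : Set where
  open FinAbGroup G
  field
    cc : CoherentConfiguration n
  open CoherentConfiguration cc public
  field
    rightInv : ∀ x y g → c (x ∙ g) (y ∙ g) ≡ c x y

module _ (G : FinAbGroup) (X : CayleyScheme G) where
  open FinAbGroup G
  open CayleyScheme X

  -- H ∈ 𝔖(X): H is the class containing e of an equivalence relation E
  -- on G which is a union of basis relations.
  InS : Subset n → Set
  InS H = Σ (Fin n → Fin n → Bool) λ E →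
            (∀ x → E x x ≡ true) ×
            (∀ x y → E x y ≡ true → E y x ≡ true) ×
            (∀ x y z → E x y ≡ true → E y z ≡ true → E x z ≡ true) ×
            (∀ x y x′ y′ → c x y ≡ c x′ y′ → E x y ≡ true → E x′ y′ ≡ true) ×
            (∀ x → (x ∈ H) ⇔ (E e x ≡ true))

  _≈[_]_ : Fin n → Subset n → Fin n → Set
  x ≈[ H ] y = (x ⁻¹ ∙ y) ∈ H

  IsWreath : Subset n → Subset n → Set
  IsWreath U L = ∀ r → (∀ x y → c x y ≡ r → ¬ (x ≈[ U ] y)) →
                 ∀ x y x′ y′ → c x y ≡ r → x ≈[ L ] x′ → y ≈[ L ] y′ → c x′ y′ ≡ r

  PermOn : (Fin n → Set) → (Fin n → Fin n) → Set
  PermOn P f = (∀ x → P x → P (f x)) ×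
               (∀ x y → P x → P y → f x ≡ f y → x ≡ y) ×
               (∀ y → P y → ∃[ x ] (P x × f x ≡ y))

  All : Fin n → Set
  All _ = Fin n

  Aut : (Fin n → Fin n) → Set
  Aut f = PermOn All f × (∀ x y → c (f x) (f y) ≡ c x y)

  -- Aut(X_U), permutations of U represented by maps G → G (values
  -- outside U irrelevant)
  AutRestr : Subset n → (Fin n → Fin n) → Set
  AutRestr U σ = PermOn (_∈ U) σ ×
                 (∀ x y → x ∈ U → y ∈ U → c (σ x) (σ y) ≡ c x y)

  -- permutations of G/L, represented by maps G → G acting on cosets
  -- (φ and ψ represent the same permutation iff φ x ≈[ L ] ψ x for all x)
  QPerm : Subset n → (Fin n → Fin n) → Set
  QPerm L φ = (∀ x y → x ≈[ L ] y → φ x ≈[ L ] φ y) ×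
              (∀ x y → φ x ≈[ L ] φ y → x ≈[ L ] y) ×
              (∀ y → ∃[ x ] φ x ≈[ L ] y)

  QRel : Subset n → Fin m → Fin n → Fin n → Set
  QRel L s x y = ∃[ x′ ] ∃[ y′ ] (x ≈[ L ] x′ × y ≈[ L ] y′ × c x′ y′ ≡ s)

  AutQuot : Subset n → (Fin n → Fin n) → Set
  AutQuot L φ = QPerm L φ × (∀ s x y → QRel L s x y ⇔ QRel L s (φ x) (φ y))

  -- setwise stabilizer of a subset P of G (resp. of U/L when P = U ⊇ L)
  StabSet : Subset n → (Fin n → Fin n) → Set
  StabSet U f = ∀ x → (x ∈ U) ⇔ (f x ∈ U)

  PreservesBlocksOn : (Fin n → Set) → Subset n → (Fin n → Fin n) → Set
  PreservesBlocksOn P L f = ∀ x y → P x → P y → (x ≈[ L ] y) ⇔ (f x ≈[ L ] f y)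

  -- Equality of two induced permutation groups K₁^Δ = K₂^Δ:
  -- K₁ f (resp. K₂ g) says f lies in the relevant setwise stabilizer,
  -- and "agree f g" says f and g induce the same permutation of Δ.
  InducedEq : ((Fin n → Fin n) → Set) → ((Fin n → Fin n) → Set) →
              ((Fin n → Fin n) → (Fin n → Fin n) → Set) → Set
  InducedEq K₁ K₂ agree =
    (∀ f → K₁ f → ∃[ g ] (K₂ g × agree f g)) ×
    (∀ g → K₂ g → ∃[ f ] (K₁ f × agree f g))

  AgreeOn : Subset n → (Fin n → Fin n) → (Fin n → Fin n) → Set
  AgreeOn U f g = ∀ x → x ∈ U → f x ≡ g x

  AgreeMod : (Fin n → Set) → Subset n → (Fin n → Fin n) → (Fin n → Fin n) → Set
  AgreeMod P L f g = ∀ x → P x → f x ≈[ L ] g x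

  HypInduced : Subset n → Subset n → Set
  HypInduced U L =
    InducedEq (λ φ → AutQuot L φ × StabSet U φ)
              (λ σ → AutRestr U σ × PreservesBlocksOn (_∈ U) L σ)
              (AgreeMod (_∈ U) L)

  Concl1 : Subset n → Set
  Concl1 U = InducedEq (λ f → Aut f × StabSet U f) (AutRestr U) (AgreeOn U)

  Concl2 : Subset n → Set
  Concl2 L = InducedEq (λ f → Aut f × PreservesBlocksOn All L f) (AutQuot L) (AgreeMod All L)

-- Restriction to U and passage to G/L map Aut(X) into Aut(X_U) and Aut(X_{G/L});
-- the content is surjectivity.  Given φ ∈ Aut(X_{G/L}), fix a representative a of
-- every U-coset.  Translating φ on aU back to U gives an automorphism of X_{G/L}
-- stabilising U, which the hypothesis lifts to some τ_a ∈ Aut(X_U) agreeing with it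
-- modulo L.  Gluing, g(y) = φ(a)·τ_a(a⁻¹y) for y ∈ aU: colours inside a U-coset are
-- preserved since τ_a is an automorphism and colours are translation invariant, and
-- colours between distinct U-cosets depend only on the L-cosets of the endpoints
-- (wreath product), where g agrees with φ.  For Aut(X)^U, lift σ ∈ Aut(X_U) to φ
-- and glue with σ itself on the coset U, represented by e.

module Submission where

open import Defs
open import Data.Bool using (true)
open import Data.Empty using (⊥-elim)
open import Data.Fin using (Fin)
open import Data.Fin.Properties using (_≟_)
open import Data.Fin.Subset using (Subset; _⊆_; _∈_)
open import Data.Fin.Subset.Properties using (_∈?_)
open import Data.List using (List; []; _∷_; allFin; filter; head)
open import Data.List.Membership.Propositional using () renaming (_∈_ to _∈ₗ_)
open import Data.List.Membership.Propositional.Properties using (∈-filter⁺; ∈-allFin)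
open import Data.List.Properties using (filter-≐; filter-accept)
open import Data.List.Relation.Unary.All using (_∷_)
open import Data.List.Relation.Unary.All.Properties using (all-filter)
open import Data.List.Relation.Unary.Any using (there)
open import Data.Maybe using (fromMaybe)
open import Data.Product using (_×_; _,_; proj₁; proj₂; ∃-syntax)
open import Function.Base using (_∘_)
open import Function.Bundles using (_⇔_; mk⇔; Equivalence)
open import Relation.Binary.Core using (Rel)
open import Relation.Binary.Definitions using (Decidable)
open import Relation.Binary.Structures using (IsEquivalence)
open import Relation.Nullary using (Dec; yes; no)
open import Relation.Binary.PropositionalEquality
open ≡-Reasoning

open Equivalence using (to; from)

module CanonicalRepresentative {n ℓ} {_~_ : Rel (Fin n) ℓ}
  (~-isEquivalence : IsEquivalence _~_) (_~?_ : Decidable _~_) (o : Fin n) where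

  open IsEquivalence ~-isEquivalence
    renaming (refl to ~-refl; sym to ~-sym; trans to ~-trans)

  -- The search list starts with o, so the class of o is represented by o itself.
  candidates : Fin n → List (Fin n)
  candidates y = filter (_~? y) (o ∷ allFin n)

  rep : Fin n → Fin n
  rep y = fromMaybe y (head (candidates y))

  rep-~ : ∀ y → rep y ~ y
  rep-~ y with candidates y | all-filter (_~? y) (o ∷ allFin n)
  ... | []    | _       = ~-refl
  ... | _ ∷ _ | z~y ∷ _ = z~y

  rep-cong : ∀ {x y} → x ~ y → rep x ≡ rep y
  rep-cong {x} {y} x~y =
    trans (head-of-nonempty (∈-filter⁺ (_~? x) (there (∈-allFin x)) ~-refl))
          (cong (fromMaybe y ∘ head) same-candidates)
    where
      same-candidates : candidates x ≡ candidates y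
      same-candidates = filter-≐ (_~? x) (_~? y)
        ((λ z~x → ~-trans z~x x~y) , (λ z~y → ~-trans z~y (~-sym x~y))) (o ∷ allFin n)
      head-of-nonempty : ∀ {xs} → x ∈ₗ xs → fromMaybe x (head xs) ≡ fromMaybe y (head xs)
      head-of-nonempty {_ ∷ _} _ = refl

  rep-o : ∀ {y} → o ~ y → rep y ≡ o
  rep-o {y} o~y rewrite filter-accept (_~? y) {xs = allFin n} o~y = refl

module AbelianGroupLemmas (G : FinAbGroup) where
  open FinAbGroup G

  inverseʳ : ∀ x → x ∙ x ⁻¹ ≡ e
  inverseʳ x = trans (comm x (x ⁻¹)) (inverseˡ x)

  x⁻¹∙[x∙y]≡y : ∀ x y → x ⁻¹ ∙ (x ∙ y) ≡ y
  x⁻¹∙[x∙y]≡y x y = begin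
    x ⁻¹ ∙ (x ∙ y) ≡⟨ assoc (x ⁻¹) x y ⟨
    x ⁻¹ ∙ x ∙ y   ≡⟨ cong (_∙ y) (inverseˡ x) ⟩
    e ∙ y          ≡⟨ identityˡ y ⟩
    y              ∎

  x∙[x⁻¹∙y]≡y : ∀ x y → x ∙ (x ⁻¹ ∙ y) ≡ y
  x∙[x⁻¹∙y]≡y x y = begin
    x ∙ (x ⁻¹ ∙ y) ≡⟨ assoc x (x ⁻¹) y ⟨
    x ∙ x ⁻¹ ∙ y   ≡⟨ cong (_∙ y) (inverseʳ x) ⟩
    e ∙ y          ≡⟨ identityˡ y ⟩
    y              ∎

  e⁻¹∙x≡x : ∀ x → e ⁻¹ ∙ x ≡ x
  e⁻¹∙x≡x x = begin
    e ⁻¹ ∙ x       ≡⟨ cong (λ z → e ⁻¹ ∙ z) (identityˡ x) ⟨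
    e ⁻¹ ∙ (e ∙ x) ≡⟨ x⁻¹∙[x∙y]≡y e x ⟩
    x              ∎

module CayleySchemeLemmas (G : FinAbGroup) (X : CayleyScheme G) where
  open FinAbGroup G
  open CayleyScheme X
  open AbelianGroupLemmas G

  c-translate : ∀ k x y → c (k ∙ x) (k ∙ y) ≡ c x y
  c-translate k x y = trans (cong₂ c (comm k x) (comm k y)) (rightInv x y k)

  c-e-x⁻¹∙y : ∀ x y → c e (x ⁻¹ ∙ y) ≡ c x y
  c-e-x⁻¹∙y x y = trans (cong (λ w → c w (x ⁻¹ ∙ y)) (sym (inverseˡ x))) (c-translate (x ⁻¹) x y)

  -- The diagonal is a union of basis relations, so colours detect equality.
  colour-preserving⇒injective : ∀ {f : Fin n → Fin n} → (∀ x y → c (f x) (f y) ≡ c x y) →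
                                ∀ x y → f x ≡ f y → x ≡ y
  colour-preserving⇒injective {f} pres x y fx≡fy = diagonal x y y (begin
    c x y         ≡⟨ pres x y ⟨
    c (f x) (f y) ≡⟨ cong (λ z → c z (f y)) fx≡fy ⟩
    c (f y) (f y) ≡⟨ pres y y ⟩
    c y y         ∎)

  Aut∩Stab⇒AutRestr : ∀ {U f} → Aut G X f → StabSet G X U f → AutRestr G X U f
  Aut∩Stab⇒AutRestr {U} {f} ((_ , f-inj , f-surj) , f-colour) f-stab =
    ((λ x x∈U → to (f-stab x) x∈U) ,
     (λ x y _ _ → f-inj x y x y) ,
     λ y y∈U → let (x , _ , fx≡y) = f-surj y y
               in x , from (f-stab x) (subst (_∈ U) (sym fx≡y) y∈U) , fx≡y) ,
    λ x y _ _ → f-colour x y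

module Cosets (G : FinAbGroup) (X : CayleyScheme G) (H : Subset (FinAbGroup.n G))
              (H∈S : InS G X H) where
  open FinAbGroup G
  open CayleyScheme X
  open AbelianGroupLemmas G
  open CayleySchemeLemmas G X

  private
    E = proj₁ H∈S
    E-refl = proj₁ (proj₂ H∈S)
    E-sym = proj₁ (proj₂ (proj₂ H∈S))
    E-trans = proj₁ (proj₂ (proj₂ (proj₂ H∈S)))
    E-colour = proj₁ (proj₂ (proj₂ (proj₂ (proj₂ H∈S))))
    E-class = proj₂ (proj₂ (proj₂ (proj₂ (proj₂ H∈S))))

  _~_ : Fin n → Fin n → Set
  x ~ y = _≈[_]_ G X x H y

  private
    ~⇒E : ∀ {x y} → x ~ y → E x y ≡ true
    ~⇒E {x} {y} x~y = E-colour e (x ⁻¹ ∙ y) x y (c-e-x⁻¹∙y x y) (to (E-class (x ⁻¹ ∙ y)) x~y)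

    E⇒~ : ∀ {x y} → E x y ≡ true → x ~ y
    E⇒~ {x} {y} Exy = from (E-class (x ⁻¹ ∙ y)) (E-colour x y e (x ⁻¹ ∙ y) (sym (c-e-x⁻¹∙y x y)) Exy)

  ~-isEquivalence : IsEquivalence _~_
  ~-isEquivalence = record
    { refl  = λ {x} → E⇒~ (E-refl x)
    ; sym   = λ {x} {y} x~y → E⇒~ (E-sym x y (~⇒E x~y))
    ; trans = λ {x} {y} {z} x~y y~z → E⇒~ (E-trans x y z (~⇒E x~y) (~⇒E y~z))
    }

  open IsEquivalence ~-isEquivalence public
    renaming (refl to ~-refl; sym to ~-sym; trans to ~-trans)

  _~?_ : Decidable _~_
  x ~? y = (x ⁻¹ ∙ y) ∈? H

  ~-colour : ∀ {x y x′ y′} → c x y ≡ c x′ y′ → x ~ y → x′ ~ y′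
  ~-colour {x} {y} {x′} {y′} eq x~y = E⇒~ (E-colour x y x′ y′ eq (~⇒E x~y))

  ~-translate : ∀ k {x y} → x ~ y → (k ∙ x) ~ (k ∙ y)
  ~-translate k {x} {y} = ~-colour (sym (c-translate k x y))

  ∈⇒e~ : ∀ {x} → x ∈ H → e ~ x
  ∈⇒e~ {x} = subst (_∈ H) (sym (e⁻¹∙x≡x x))

  e~⇒∈ : ∀ {x} → e ~ x → x ∈ H
  e~⇒∈ {x} = subst (_∈ H) (e⁻¹∙x≡x x)

  ∈⇒~∙ : ∀ a {z} → z ∈ H → a ~ (a ∙ z)
  ∈⇒~∙ a {z} = subst (_∈ H) (sym (x⁻¹∙[x∙y]≡y a z))

  ∈-resp-~ : ∀ {x y} → x ∈ H → x ~ y → y ∈ H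
  ∈-resp-~ x∈H x~y = e~⇒∈ (~-trans (∈⇒e~ x∈H) x~y)

  AutRestr⇒PreservesBlocks : ∀ {U σ} → AutRestr G X U σ → PreservesBlocksOn G X (_∈ U) H σ
  AutRestr⇒PreservesBlocks (_ , σ-colour) x y x∈U y∈U =
    mk⇔ (~-colour (sym (σ-colour x y x∈U y∈U))) (~-colour (σ-colour x y x∈U y∈U))

  AutRestr-translate : ∀ {k σ} → k ∈ H → AutRestr G X H σ → AutRestr G X H (λ z → k ⁻¹ ∙ σ z)
  AutRestr-translate {k} {σ} k∈H ((σ-maps , σ-inj , σ-surj) , σ-colour) =
    ((λ x x∈H → ~-trans (~-sym (∈⇒e~ k∈H)) (∈⇒e~ (σ-maps x x∈H))) ,
     (λ x y x∈H y∈H eq → σ-inj x y x∈H y∈H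
        (trans (sym (x∙[x⁻¹∙y]≡y k (σ x))) (trans (cong (k ∙_) eq) (x∙[x⁻¹∙y]≡y k (σ y))))) ,
     λ y y∈H → let (x , x∈H , σx≡ky) = σ-surj (k ∙ y) (e~⇒∈ (~-trans (∈⇒e~ k∈H) (∈⇒~∙ k y∈H)))
               in x , x∈H , trans (cong (k ⁻¹ ∙_) σx≡ky) (x⁻¹∙[x∙y]≡y k y)) ,
    λ x y x∈H y∈H → trans (c-translate (k ⁻¹) (σ x) (σ y)) (σ-colour x y x∈H y∈H)

module QuotientAutomorphisms (G : FinAbGroup) (X : CayleyScheme G) (L : Subset (FinAbGroup.n G))
                             (L∈S : InS G X L) where
  open FinAbGroup G
  open CayleyScheme X
  open AbelianGroupLemmas G
  open CayleySchemeLemmas G X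
  open Cosets G X L L∈S

  QRel-self : ∀ x y → QRel G X L (c x y) x y
  QRel-self x y = x , y , ~-refl , ~-refl , refl

  QRel-translate : ∀ k {s x y} → QRel G X L s x y → QRel G X L s (k ∙ x) (k ∙ y)
  QRel-translate k (x′ , y′ , x~x′ , y~y′ , c≡s) =
    k ∙ x′ , k ∙ y′ , ~-translate k x~x′ , ~-translate k y~y′ , trans (c-translate k x′ y′) c≡s

  AutQuot-translate : ∀ k → AutQuot G X L (k ∙_)
  AutQuot-translate k =
    ((λ _ _ → ~-translate k) ,
     (λ x y → subst₂ _~_ (x⁻¹∙[x∙y]≡y k x) (x⁻¹∙[x∙y]≡y k y) ∘ ~-translate (k ⁻¹)) ,
     λ y → k ⁻¹ ∙ y , subst (_~ y) (sym (x∙[x⁻¹∙y]≡y k y)) ~-refl) ,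
    λ s x y → mk⇔ (QRel-translate k)
      (subst₂ (QRel G X L s) (x⁻¹∙[x∙y]≡y k x) (x⁻¹∙[x∙y]≡y k y) ∘ QRel-translate (k ⁻¹))

  AutQuot-∘ : ∀ {f h} → AutQuot G X L f → AutQuot G X L h → AutQuot G X L (f ∘ h)
  AutQuot-∘ ((f-blocks , f-blocks⁻ , f-surj) , f-rel) ((h-blocks , h-blocks⁻ , h-surj) , h-rel) =
    ((λ x y → f-blocks _ _ ∘ h-blocks x y) ,
     (λ x y → h-blocks⁻ x y ∘ f-blocks⁻ _ _) ,
     λ y → let (w , fw~y) = f-surj y ; (x , hx~w) = h-surj w
           in x , ~-trans (f-blocks _ _ hx~w) fw~y) ,
    λ s x y → mk⇔ (to (f-rel s _ _) ∘ to (h-rel s x y)) (from (h-rel s x y) ∘ from (f-rel s _ _))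

  Aut∩Blocks⇒AutQuot : ∀ {f} → Aut G X f → PreservesBlocksOn G X (All G X) L f → AutQuot G X L f
  Aut∩Blocks⇒AutQuot {f} ((_ , _ , f-surj) , f-colour) f-blocks =
    ((λ x y → to (f-blocks x y x y)) ,
     (λ x y → from (f-blocks x y x y)) ,
     λ y → let (x , _ , fx≡y) = f-surj y y in x , subst (f x ~_) fx≡y ~-refl) ,
    λ s x y → mk⇔ image preimage
    where
      image : ∀ {s x y} → QRel G X L s x y → QRel G X L s (f x) (f y)
      image {x = x} {y} (x′ , y′ , x~x′ , y~y′ , c≡s) =
        f x′ , f y′ , to (f-blocks x x′ x x′) x~x′ , to (f-blocks y y′ y y′) y~y′ ,
        trans (f-colour x′ y′) c≡s
      preimage : ∀ {s x y} → QRel G X L s (f x) (f y) → QRel G X L s x y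
      preimage {x = x} {y} (u , v , fx~u , fy~v , c≡s) =
        let (x′ , _ , fx′≡u) = f-surj u u ; (y′ , _ , fy′≡v) = f-surj v v
        in x′ , y′ ,
           from (f-blocks x x′ x x′) (subst (f x ~_) (sym fx′≡u) fx~u) ,
           from (f-blocks y y′ y y′) (subst (f y ~_) (sym fy′≡v) fy~v) ,
           trans (sym (f-colour x′ y′)) (trans (cong₂ c fx′≡u fy′≡v) c≡s)

module WreathProduct (G : FinAbGroup) (X : CayleyScheme G) (U L : Subset (FinAbGroup.n G))
                     (U∈S : InS G X U) (L∈S : InS G X L) (L⊆U : L ⊆ U)
                     (wreath : IsWreath G X U L) where
  open FinAbGroup G
  open CayleyScheme X
  open AbelianGroupLemmas G
  open CayleySchemeLemmas G X
  open QuotientAutomorphisms G X L L∈S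
  open Cosets G X U U∈S using (AutRestr-translate)
    renaming ( _~_ to _~U_; ~-isEquivalence to ~U-isEquivalence; _~?_ to _~U?_
             ; ~-refl to ~U-refl; ~-sym to ~U-sym; ~-trans to ~U-trans; ~-colour to ~U-colour
             ; ∈⇒e~ to ∈U⇒e~U; e~⇒∈ to e~U⇒∈U; ∈⇒~∙ to ∈U⇒~U∙; ∈-resp-~ to ∈U-resp-~U)
  open Cosets G X L L∈S using (AutRestr⇒PreservesBlocks)
    renaming (_~_ to _~L_; ~-refl to ~L-refl; ~-sym to ~L-sym; ~-trans to ~L-trans; ~-translate to ~L-translate)
  open CanonicalRepresentative ~U-isEquivalence _~U?_ e

  ~L⇒~U : ∀ {x y} → x ~L y → x ~U y
  ~L⇒~U = L⊆U

  QRel-transfers-~U : ∀ {s x y x′ y′} → QRel G X L s x y → QRel G X L s x′ y′ → x ~U y → x′ ~U y′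
  QRel-transfers-~U (u , v , x~u , y~v , cuv≡s) (u′ , v′ , x′~u′ , y′~v′ , cu′v′≡s) x~y =
    ~U-trans (~L⇒~U x′~u′) (~U-trans (~U-colour (trans cuv≡s (sym cu′v′≡s)) u~v) (~L⇒~U (~L-sym y′~v′)))
    where
      u~v : u ~U v
      u~v = ~U-trans (~U-sym (~L⇒~U x~u)) (~U-trans x~y (~L⇒~U y~v))

  AutQuot-preserves-~U : ∀ {φ} → AutQuot G X L φ → ∀ {x y} → x ~U y → φ x ~U φ y
  AutQuot-preserves-~U (_ , φ-rel) {x} {y} =
    QRel-transfers-~U (QRel-self x y) (to (φ-rel (c x y) x y) (QRel-self x y))

  AutQuot-reflects-~U : ∀ {φ} → AutQuot G X L φ → ∀ {x y} → φ x ~U φ y → x ~U y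
  AutQuot-reflects-~U {φ} (_ , φ-rel) {x} {y} =
    QRel-transfers-~U (QRel-self (φ x) (φ y)) (from (φ-rel _ x y) (QRel-self (φ x) (φ y)))

  -- φ on the coset aU, translated back so that it maps U to U modulo L.
  localize : (Fin n → Fin n) → Fin n → Fin n → Fin n
  localize φ a z = φ a ⁻¹ ∙ φ (a ∙ z)

  localize-AutQuot : ∀ {φ} → AutQuot G X L φ → ∀ a → AutQuot G X L (localize φ a)
  localize-AutQuot {φ} φ-aut a =
    AutQuot-∘ (AutQuot-translate (φ a ⁻¹)) (AutQuot-∘ φ-aut (AutQuot-translate a))

  localize-StabSet : ∀ {φ} → AutQuot G X L φ → ∀ a → StabSet G X U (localize φ a)
  localize-StabSet φ-aut a z = mk⇔
    (λ z∈U → AutQuot-preserves-~U φ-aut (∈U⇒~U∙ a z∈U))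
    (λ ψz∈U → subst (_∈ U) (x⁻¹∙[x∙y]≡y a z) (AutQuot-reflects-~U φ-aut ψz∈U))

  rep⁻¹∙∈U : ∀ {a y} → rep y ≡ a → (a ⁻¹ ∙ y) ∈ U
  rep⁻¹∙∈U {y = y} refl = rep-~ y

  module Gluing {φ} (φ-aut : AutQuot G X L φ) (T : Fin n → Fin n → Fin n)
                (T-aut : ∀ a → AutRestr G X U (T a))
                (T≈localize : ∀ a → AgreeMod G X (_∈ U) L (localize φ a) (T a)) where
    private
      φ-blocks = proj₁ (proj₁ φ-aut)
      φ-blocks⁻ = proj₁ (proj₂ (proj₁ φ-aut))
      φ-surj = proj₂ (proj₂ (proj₁ φ-aut))

    glue : Fin n → Fin n
    glue y = φ a ∙ T a (a ⁻¹ ∙ y)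
      where a = rep y

    glue-at : ∀ {a y} → rep y ≡ a → glue y ≡ φ a ∙ T a (a ⁻¹ ∙ y)
    glue-at refl = refl

    glue~Lφ : ∀ y → glue y ~L φ y
    glue~Lφ y =
      subst (glue y ~L_) (trans (x∙[x⁻¹∙y]≡y (φ a) _) (cong φ (x∙[x⁻¹∙y]≡y a y)))
            (~L-translate (φ a) (~L-sym (T≈localize a (a ⁻¹ ∙ y) (rep-~ y))))
      where a = rep y

    -- Inside a U-coset glue is a translate of some T a; across U-cosets X is a wreath product.
    glue-colour : ∀ x y → c (glue x) (glue y) ≡ c x y
    glue-colour x y with x ~U? y
    ... | yes x~y = begin
      c (glue x) (glue y)             ≡⟨ cong (c (glue x)) (glue-at (sym (rep-cong x~y))) ⟩
      c (φ a ∙ T a u) (φ a ∙ T a v)   ≡⟨ c-translate (φ a) (T a u) (T a v) ⟩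
      c (T a u) (T a v)               ≡⟨ proj₂ (T-aut a) u v (rep-~ x) (rep⁻¹∙∈U (sym (rep-cong x~y))) ⟩
      c u v                           ≡⟨ c-translate (a ⁻¹) x y ⟩
      c x y                           ∎
      where
        a = rep x
        u = a ⁻¹ ∙ x
        v = a ⁻¹ ∙ y
    ... | no x≁y =
      let (u , v , φx~u , φy~v , cuv≡cxy) = to (proj₂ φ-aut (c x y) x y) (QRel-self x y)
      in wreath (c x y) (λ _ _ c≡cxy x′~y′ → x≁y (~U-colour c≡cxy x′~y′)) u v (glue x) (glue y)
                cuv≡cxy (~L-trans (~L-sym φx~u) (~L-sym (glue~Lφ x)))
                        (~L-trans (~L-sym φy~v) (~L-sym (glue~Lφ y)))

    glue-surjective : ∀ w → ∃[ x ] glue x ≡ w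
    glue-surjective w = a ∙ z , (begin
      glue (a ∙ z)                ≡⟨ glue-at rep[a∙z]≡a ⟩
      φ a ∙ T a (a ⁻¹ ∙ (a ∙ z))  ≡⟨ cong (λ q → φ a ∙ T a q) (x⁻¹∙[x∙y]≡y a z) ⟩
      φ a ∙ T a z                 ≡⟨ cong (φ a ∙_) Tz≡φa⁻¹∙w ⟩
      φ a ∙ (φ a ⁻¹ ∙ w)          ≡⟨ x∙[x⁻¹∙y]≡y (φ a) w ⟩
      w                           ∎)
      where
        x₀ = proj₁ (φ-surj w)
        a = rep x₀
        φa~w : φ a ~U w
        φa~w = ~U-trans (AutQuot-preserves-~U φ-aut (rep-~ x₀)) (~L⇒~U (proj₂ (φ-surj w)))
        T-preimage = proj₂ (proj₂ (proj₁ (T-aut a))) (φ a ⁻¹ ∙ w) φa~w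
        z = proj₁ T-preimage
        z∈U = proj₁ (proj₂ T-preimage)
        Tz≡φa⁻¹∙w = proj₂ (proj₂ T-preimage)
        rep[a∙z]≡a : rep (a ∙ z) ≡ a
        rep[a∙z]≡a = trans (sym (rep-cong (∈U⇒~U∙ a z∈U))) (rep-cong (rep-~ x₀))

    glue-Aut : Aut G X glue
    glue-Aut =
      ((λ x _ → glue x) ,
       (λ x y _ _ → colour-preserving⇒injective glue-colour x y) ,
       λ w _ → let (x , glue-x≡w) = glue-surjective w in x , x , glue-x≡w) ,
      glue-colour

    glue-blocks : PreservesBlocksOn G X (All G X) L glue
    glue-blocks x y _ _ = mk⇔
      (λ x~y → ~L-trans (glue~Lφ x) (~L-trans (φ-blocks x y x~y) (~L-sym (glue~Lφ y))))
      (λ gx~gy → φ-blocks⁻ x y (~L-trans (~L-sym (glue~Lφ x)) (~L-trans gx~gy (glue~Lφ y))))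

  module _ (hyp : HypInduced G X U L) where

    restrict : ∀ φ → AutQuot G X L φ → ∀ a →
               ∃[ τ ] ((AutRestr G X U τ × PreservesBlocksOn G X (_∈ U) L τ) ×
                       AgreeMod G X (_∈ U) L (localize φ a) τ)
    restrict φ φ-aut a = proj₁ hyp _ (localize-AutQuot φ-aut a , localize-StabSet φ-aut a)

    Aut^G/L≡AutQuot : Concl2 G X L
    Aut^G/L≡AutQuot =
      (λ f (f-aut , f-blocks) → f , Aut∩Blocks⇒AutQuot f-aut f-blocks , λ _ _ → ~L-refl) ,
      λ φ φ-aut →
        let open Gluing φ-aut (λ a → proj₁ (restrict φ φ-aut a))
                              (λ a → proj₁ (proj₁ (proj₂ (restrict φ φ-aut a))))
                              (λ a → proj₂ (proj₂ (restrict φ φ-aut a)))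
        in glue , (glue-Aut , glue-blocks) , λ x _ → glue~Lφ x

    module Extension {σ φ} (σ-aut : AutRestr G X U σ) (φ-aut : AutQuot G X L φ)
                     (φ-stab : StabSet G X U φ) (φ≈σ : AgreeMod G X (_∈ U) L φ σ) where

      φe∈U : φ e ∈ U
      φe∈U = to (φ-stab e) (e~U⇒∈U ~U-refl)

      -- Over U itself glue must return σ exactly, not just modulo L.
      local : ∀ a → Dec (a ≡ e) → Fin n → Fin n
      local a (yes _) z = φ e ⁻¹ ∙ σ z
      local a (no _)    = proj₁ (restrict φ φ-aut a)

      local-aut : ∀ a d → AutRestr G X U (local a d)
      local-aut a (yes _) = AutRestr-translate φe∈U σ-aut
      local-aut a (no _)  = proj₁ (proj₁ (proj₂ (restrict φ φ-aut a)))

      local≈localize : ∀ a d → AgreeMod G X (_∈ U) L (localize φ a) (local a d)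
      local≈localize a (yes refl) z z∈U =
        subst (λ w → (φ e ⁻¹ ∙ φ w) ~L (φ e ⁻¹ ∙ σ z)) (sym (identityˡ z))
              (~L-translate (φ e ⁻¹) (φ≈σ z z∈U))
      local≈localize a (no _) = proj₂ (proj₂ (restrict φ φ-aut a))

      T : Fin n → Fin n → Fin n
      T a = local a (a ≟ e)

      T-e : ∀ z → T e z ≡ φ e ⁻¹ ∙ σ z
      T-e z with e ≟ e
      ... | yes _  = refl
      ... | no e≢e = ⊥-elim (e≢e refl)

      open Gluing φ-aut T (λ a → local-aut a (a ≟ e)) (λ a → local≈localize a (a ≟ e)) public

      glue-on-U : AgreeOn G X U glue σ
      glue-on-U y y∈U = begin
        glue y                         ≡⟨ glue-at (rep-o (∈U⇒e~U y∈U)) ⟩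
        φ e ∙ T e (e ⁻¹ ∙ y)           ≡⟨ cong (φ e ∙_) (T-e (e ⁻¹ ∙ y)) ⟩
        φ e ∙ (φ e ⁻¹ ∙ σ (e ⁻¹ ∙ y))  ≡⟨ x∙[x⁻¹∙y]≡y (φ e) _ ⟩
        σ (e ⁻¹ ∙ y)                   ≡⟨ cong σ (e⁻¹∙x≡x y) ⟩
        σ y                            ∎

      glue-StabSet : StabSet G X U glue
      glue-StabSet x = mk⇔
        (λ x∈U → ∈U-resp-~U (to (φ-stab x) x∈U) (~L⇒~U (~L-sym (glue~Lφ x))))
        (λ gx∈U → from (φ-stab x) (∈U-resp-~U gx∈U (~L⇒~U (glue~Lφ x))))

    Aut^U≡AutRestr : Concl1 G X U
    Aut^U≡AutRestr =
      (λ f (f-aut , f-stab) → f , Aut∩Stab⇒AutRestr f-aut f-stab , λ _ _ → refl) ,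
      λ σ σ-aut →
        let (_ , (φ-aut , φ-stab) , φ≈σ) = proj₂ hyp σ (σ-aut , AutRestr⇒PreservesBlocks σ-aut)
            open Extension σ-aut φ-aut φ-stab φ≈σ
        in glue , (glue-Aut , glue-StabSet) , glue-on-U

theorem4p1 : (G : FinAbGroup) (X : CayleyScheme G) (U L : Subset (FinAbGroup.n G)) →
    InS G X U → InS G X L → L ⊆ U → IsWreath G X U L → HypInduced G X U L →
    Concl1 G X U × Concl2 G X L
theorem4p1 G X U L U∈S L∈S L⊆U wreath hyp = Aut^U≡AutRestr hyp , Aut^G/L≡AutQuot hyp
  where open WreathProduct G X U L U∈S L∈S L⊆U wreath
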